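{- Let $\{q_n\}$ be the Fibonacci Quilt sequence and let $h_n$ be the number of integers $m\in[1,q_{n+1}-1]$ for which the greedy algorithm produces an FQ-legal decomposition. Then $h_k=k$ for $1\le k\le5$, and for all $n\ge6$, $$h_n=h_{n-1}+h_{n-5}+1.$$
   Context: Given an increasing sequence of positive integers $\{q_i\}_{i\ge1}$, a decomposition $m=q_{\ell_1}+\cdots+q_{\ell_t}$ with $q_{\ell_1}>\cdots>q_{\ell_t}$ is FQ-legal if $|\ell_i-\ell_j|\notin\{0,1,3,4\}$ for all $i\neq j$ and $\{1,3\}\not\subset\{\ell_1,\dots,\ell_t\}$. The Fibonacci Quilt sequence is the increasing sequence $\{q_i\}_{i\ge1}$ of positive integers in which each $q_i$ is the smallest positive integer with no FQ-legal decomposition using elements of $\{q_1,\dots,q_{i-1}\}$ (so it begins $1,2,3,4,5,7,9,12,16,\dots$). The greedy algorithm applied to a positive integer $m$ repeatedly subtracts the largest term $q_k$ not exceeding the current remainder until the remainder is $0$, producing a decomposition of $m$ as the sum of the chosen terms. -}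

module Defs where

open import Data.Nat using (ℕ; zero; suc; _+_; _∸_; _≟_; _≤ᵇ_; ∣_-_∣)
open import Data.Bool using (Bool; true; false; if_then_else_; not; _∧_)
open import Data.List using (List; []; _∷_; _++_; map; length; filter; upTo)
open import Data.Bool.ListAction using (any)
open import Data.Nat.ListAction using (sum)
open import Data.List.Relation.Unary.AllPairs using (AllPairs; allPairs?)
open import Data.List.Membership.DecPropositional _≟_ using (_∈_; _∈?_)
open import Data.Product using (_×_)
open import Relation.Binary.PropositionalEquality using (_≡_; _≢_)
open import Relation.Nullary using (¬_; Dec; does; ¬?)
open import Relation.Nullary.Decidable using (_×-dec_)

-- Decompositions are lists of (1-based) indices ℓ₁ > ⋯ > ℓₜ.

OkGap : ℕ → Set
OkGap d = d ≢ 0 × d ≢ 1 × d ≢ 3 × d ≢ 4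

okGap? : (d : ℕ) → Dec (OkGap d)
okGap? d = ¬? (d ≟ 0) ×-dec ¬? (d ≟ 1) ×-dec ¬? (d ≟ 3) ×-dec ¬? (d ≟ 4)

FQLegal : List ℕ → Set
FQLegal ls = AllPairs (λ a b → OkGap ∣ a - b ∣) ls × ¬ (1 ∈ ls × 3 ∈ ls)

fqLegal? : (ls : List ℕ) → Dec (FQLegal ls)
fqLegal? ls = allPairs? (λ a b → okGap? ∣ a - b ∣) ls ×-dec ¬? ((1 ∈? ls) ×-dec (3 ∈? ls))

-- i-th element (1-based) of a list, 0 if out of range
nth : List ℕ → ℕ → ℕ
nth [] _ = 0
nth (x ∷ xs) zero = 0
nth (x ∷ xs) (suc zero) = x
nth (x ∷ xs) (suc (suc i)) = nth xs (suc i)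

subsets : ℕ → List (List ℕ)
subsets zero = [] ∷ []
subsets (suc n) = subsets n ++ map (suc n ∷_) (subsets n)

hasDec : List ℕ → ℕ → Bool
hasDec ts m = any (λ ls → does (fqLegal? ls) ∧ does (sum (map (nth ts) ls) ≟ m))
                  (subsets (length ts))

firstNoDec : List ℕ → List ℕ → ℕ → ℕ
firstNoDec ts [] dflt = dflt
firstNoDec ts (m ∷ ms) dflt = if hasDec ts m then firstNoDec ts ms dflt else m

-- the next term: smallest positive integer with no FQ-legal decomposition
-- (it is at most sum ts + 1, which has no decomposition at all)
next : List ℕ → ℕ
next ts = firstNoDec ts (map suc (upTo (suc (sum ts)))) (suc (sum ts))

terms : ℕ → List ℕ
terms zero = []
terms (suc n) = terms n ++ (next (terms n) ∷ [])

-- The Fibonacci Quilt sequence, 1-based (q 0 = 0 is unused)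
q : ℕ → ℕ
q i = nth (terms i) i

largestIdx : ℕ → ℕ → ℕ
largestIdx m zero = zero
largestIdx m (suc k) = if q (suc k) ≤ᵇ m then suc k else largestIdx m k

-- greedy algorithm with fuel; since q k ≥ k, the largest k with q k ≤ m is ≤ m,
-- and each step decreases the remainder by ≥ 1, so fuel m suffices.
greedyF : ℕ → ℕ → List ℕ
greedyF zero m = []
greedyF (suc f) zero = []
greedyF (suc f) (suc m) =
  let k = largestIdx (suc m) (suc m) in k ∷ greedyF f (suc m ∸ q k)

greedy : ℕ → List ℕ
greedy m = greedyF m m

h : ℕ → ℕ
h n = length (filter (λ m → fqLegal? (greedy m)) (map suc (upTo (q (suc n) ∸ 1))))

-- From q₇ = 9 on, the Fibonacci Quilt sequence satisfies q(n+1) = q(n) + q(n-4). Indeed, by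
-- induction on n, every m < q(n+1) has an FQ-legal decomposition into q₁, …, qₙ (take qₙ and
-- decompose m - qₙ < q(n-4) with indices at most n-5), while q(n+1) has none (its largest term
-- must be q(n-1) or qₙ, and the FQ gap conditions push the rest into a smaller instance of
-- the same claim).
--
-- For m = qₙ + r with r < q(n-4) the greedy algorithm picks qₙ and then runs on r, whose greedy
-- indices are at most n-5, so that prepending n preserves legality. Hence the numbers of
-- legal greedy decompositions in [qₙ, q(n+1)) and in [0, q(n-4)) agree, which is the
-- recurrence for h.

module Submission where

open import Defs
open import Data.Nat
open import Data.Nat.Properties
open import Data.Nat.ListAction using (sum)
open import Data.Bool.ListAction using (any)
open import Data.Nat.ListAction.Properties using (sum-++)
open import Data.Bool using (Bool; true; false; if_then_else_; T)
open import Data.Unit using (tt)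
open import Data.Empty using (⊥-elim)
open import Data.Product using (_×_; _,_; proj₂; ∃-syntax)
open import Data.Sum using (_⊎_; inj₁; inj₂)
open import Data.List using (List; []; _∷_; _++_; map; length; upTo; applyUpTo; filter)
open import Data.List.Properties using (length-++; map-upTo)
open import Data.List.Relation.Unary.All using (All; []; _∷_; all?)
import Data.List.Relation.Unary.All as All
open import Data.List.Relation.Unary.Any using (here; there)
open import Data.List.Relation.Unary.Any.Properties using (any⁺; any⁻)
open import Data.List.Relation.Unary.AllPairs using (AllPairs; []; _∷_; allPairs?)
open import Data.List.Membership.Propositional using (_∈_; find; lose)
open import Data.List.Membership.Propositional.Properties using (∈-++⁺ˡ; ∈-++⁺ʳ; ∈-++⁻; ∈-map⁺; ∈-map⁻)
open import Relation.Binary.PropositionalEquality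
open import Relation.Nullary using (¬_; Dec; yes; no; does)
open import Relation.Nullary.Decidable using (True; toWitness; _×-dec_; dec-true; does-⇔)
open import Relation.Nullary.Reflects using (ofʸ; ofⁿ)
open import Relation.Unary using (Decidable)
open import Function using (_∘_; mk⇔)

-- The recurrence

Q : ℕ → ℕ
Q 0 = 0
Q 1 = 1
Q 2 = 2
Q 3 = 3
Q 4 = 4
Q 5 = 5
Q 6 = 7
Q (suc (suc (suc (suc (suc (suc (suc k))))))) = Q (suc (suc (suc (suc (suc (suc k)))))) + Q (suc (suc k))

Q[n]<Q[1+n] : ∀ n → Q n < Q (suc n)
Q[n]<Q[1+n] 0 = ≤ᵇ⇒≤ _ _ tt
Q[n]<Q[1+n] 1 = ≤ᵇ⇒≤ _ _ tt
Q[n]<Q[1+n] 2 = ≤ᵇ⇒≤ _ _ tt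
Q[n]<Q[1+n] 3 = ≤ᵇ⇒≤ _ _ tt
Q[n]<Q[1+n] 4 = ≤ᵇ⇒≤ _ _ tt
Q[n]<Q[1+n] 5 = ≤ᵇ⇒≤ _ _ tt
Q[n]<Q[1+n] (suc (suc (suc (suc (suc (suc k)))))) =
  m<m+n (Q (6 + k)) (≤-<-trans z≤n (Q[n]<Q[1+n] (suc k)))

Q-pos : ∀ n → 0 < Q (suc n)
Q-pos n = ≤-<-trans z≤n (Q[n]<Q[1+n] n)

Q-mono-< : ∀ {i j} → i < j → Q i < Q j
Q-mono-< {i} {suc j} (s≤s i≤j) with m≤n⇒m<n∨m≡n i≤j
... | inj₁ i<j  = <-trans (Q-mono-< i<j) (Q[n]<Q[1+n] j)
... | inj₂ refl = Q[n]<Q[1+n] i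

Q-mono-≤ : ∀ {i j} → i ≤ j → Q i ≤ Q j
Q-mono-≤ i≤j with m≤n⇒m<n∨m≡n i≤j
... | inj₁ i<j  = <⇒≤ (Q-mono-< i<j)
... | inj₂ refl = ≤-refl

Q-cancel-< : ∀ {i j} → Q i < Q j → i < j
Q-cancel-< Qi<Qj = ≰⇒> (λ j≤i → <⇒≱ Qi<Qj (Q-mono-≤ j≤i))

n≤Q[n] : ∀ n → n ≤ Q n
n≤Q[n] zero    = z≤n
n≤Q[n] (suc n) = ≤-trans (s≤s (n≤Q[n] n)) (Q[n]<Q[1+n] n)

Q[5+n]≡Q[3+n]+Q[2+n] : ∀ n → Q (5 + n) ≡ Q (3 + n) + Q (2 + n)
Q[5+n]≡Q[3+n]+Q[2+n] 0 = refl
Q[5+n]≡Q[3+n]+Q[2+n] 1 = refl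
Q[5+n]≡Q[3+n]+Q[2+n] 2 = refl
Q[5+n]≡Q[3+n]+Q[2+n] (suc (suc (suc k))) = begin
  Q (7 + k) + Q (3 + k)                ≡⟨ cong (_+ Q (3 + k)) (Q[5+n]≡Q[3+n]+Q[2+n] (suc (suc k))) ⟩
  Q (5 + k) + Q (4 + k) + Q (3 + k)    ≡⟨ +-assoc (Q (5 + k)) _ _ ⟩
  Q (5 + k) + (Q (4 + k) + Q (3 + k))  ≡⟨ cong (Q (5 + k) +_) (Q[5+n]≡Q[3+n]+Q[2+n] (suc k)) ⟨
  Q (5 + k) + Q (6 + k)                ≡⟨ +-comm (Q (5 + k)) _ ⟩
  Q (6 + k) + Q (5 + k)                ∎
  where open ≡-Reasoning

Q[n]+Q[1+n]≤Q[3+n] : ∀ n → Q n + Q (suc n) ≤ Q (3 + n)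
Q[n]+Q[1+n]≤Q[3+n] 0 = ≤ᵇ⇒≤ _ _ tt
Q[n]+Q[1+n]≤Q[3+n] 1 = ≤ᵇ⇒≤ _ _ tt
Q[n]+Q[1+n]≤Q[3+n] (suc (suc k)) =
  ≤-reflexive (trans (+-comm (Q (2 + k)) _) (sym (Q[5+n]≡Q[3+n]+Q[2+n] k)))

-- Decompositions

Decreasing : List ℕ → Set
Decreasing = AllPairs _>_

Within : ℕ → ℕ → Set
Within n i = 1 ≤ i × i ≤ n

value : List ℕ → ℕ
value ls = sum (map Q ls)

Representable : ℕ → ℕ → Set
Representable n m = ∃[ ls ] Decreasing ls × FQLegal ls × All (Within n) ls × value ls ≡ m

legal-tail : ∀ {x xs} → FQLegal (x ∷ xs) → FQLegal xs
legal-tail (_ ∷ gaps , ¬1,3) = gaps , λ (1∈ , 3∈) → ¬1,3 (there 1∈ , there 3∈)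

∣m+n-n∣≡m : ∀ m n → ∣ m + n - n ∣ ≡ m
∣m+n-n∣≡m m n = trans (m≤n⇒∣n-m∣≡n∸m (m≤n+m n m)) (m+n∸n≡m m n)

¬OkGap[1] : ∀ n → ¬ OkGap ∣ 1 + n - n ∣
¬OkGap[1] n (_ , ≢1 , _) = ≢1 (∣m+n-n∣≡m 1 n)

¬OkGap[3] : ∀ n → ¬ OkGap ∣ 3 + n - n ∣
¬OkGap[3] n (_ , _ , ≢3 , _) = ≢3 (∣m+n-n∣≡m 3 n)

¬OkGap[4] : ∀ n → ¬ OkGap ∣ 4 + n - n ∣
¬OkGap[4] n (_ , _ , _ , ≢4) = ≢4 (∣m+n-n∣≡m 4 n)

OkGap[5+n] : ∀ n → OkGap (5 + n)
OkGap[5+n] n = (λ ()) , (λ ()) , (λ ()) , (λ ())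

OkGap⇒2+≤ : ∀ {a b} → b < a → OkGap ∣ a - b ∣ → 2 + b ≤ a
OkGap⇒2+≤ {a} {b} b<a (_ , ≢1 , _) with m≤n⇒m<n∨m≡n b<a
... | inj₁ 1+b<a = 1+b<a
... | inj₂ refl  = ⊥-elim (≢1 (∣m+n-n∣≡m 1 b))

legal-∷ : ∀ k {ls} → All (_≤ k) ls → FQLegal ls → FQLegal (5 + k ∷ ls)
legal-∷ k ls≤k (gaps , ¬1,3) = All.map far ls≤k ∷ gaps , ¬1,3′
  where
  far : ∀ {i} → i ≤ k → OkGap ∣ 5 + k - i ∣
  far {i} i≤k = subst OkGap
    (sym (trans (m≤n⇒∣n-m∣≡n∸m (≤-trans i≤k (m≤n+m k 5))) (+-∸-assoc 5 i≤k)))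
    (OkGap[5+n] (k ∸ i))
  ¬1,3′ : ¬ (1 ∈ 5 + k ∷ _ × 3 ∈ 5 + k ∷ _)
  ¬1,3′ (there 1∈ , there 3∈) = ¬1,3 (1∈ , 3∈)

<5+-cases : ∀ n {x} → x < 5 + n → x ≤ n ⊎ x ≡ 1 + n ⊎ x ≡ 2 + n ⊎ x ≡ 3 + n ⊎ x ≡ 4 + n
<5+-cases n x<5+n with m<1+n⇒m<n∨m≡n x<5+n
... | inj₂ x≡4+n = inj₂ (inj₂ (inj₂ (inj₂ x≡4+n)))
... | inj₁ x<4+n with m<1+n⇒m<n∨m≡n x<4+n
... | inj₂ x≡3+n = inj₂ (inj₂ (inj₂ (inj₁ x≡3+n)))
... | inj₁ x<3+n with m<1+n⇒m<n∨m≡n x<3+n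
... | inj₂ x≡2+n = inj₂ (inj₂ (inj₁ x≡2+n))
... | inj₁ x<2+n with m<1+n⇒m<n∨m≡n x<2+n
... | inj₂ x≡1+n = inj₂ (inj₁ x≡1+n)
... | inj₁ x<1+n = inj₁ (≤-pred x<1+n)

≤2+-cases : ∀ n {x} → x ≤ 2 + n → x ≤ n ⊎ x ≡ 1 + n ⊎ x ≡ 2 + n
≤2+-cases n x≤2+n with m≤n⇒m<n∨m≡n x≤2+n
... | inj₂ x≡2+n = inj₂ (inj₂ x≡2+n)
... | inj₁ x<2+n with m<1+n⇒m<n∨m≡n x<2+n
... | inj₂ x≡1+n = inj₂ (inj₁ x≡1+n)
... | inj₁ x<1+n = inj₁ (≤-pred x<1+n)

within-restrict : ∀ {m n xs} → All (_≤ m) xs → All (Within n) xs → All (Within m) xs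
within-restrict []           []              = []
within-restrict (x≤m ∷ xs≤m) ((1≤x , _) ∷ w) = (1≤x , x≤m) ∷ within-restrict xs≤m w

within-suc : ∀ {n xs} → All (Within n) xs → All (Within (suc n)) xs
within-suc = All.map (λ (1≤i , i≤n) → 1≤i , m≤n⇒m≤1+n i≤n)

decreasing-within : ∀ {x m n xs} → x ≤ m → Decreasing (x ∷ xs) → All (Within n) (x ∷ xs) →
                    All (Within m) (x ∷ xs)
decreasing-within x≤m (xs<x ∷ _) ((1≤x , _) ∷ w) =
  (1≤x , x≤m) ∷ within-restrict (All.map (λ i<x → ≤-trans (<⇒≤ i<x) x≤m) xs<x) w

Q≤value : ∀ ls → All (λ i → Q i ≤ value ls) ls
Q≤value []       = []
Q≤value (i ∷ ls) = m≤m+n (Q i) (value ls) ∷ All.map (λ le → ≤-trans le (m≤n+m _ (Q i))) (Q≤value ls)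

value<Q[3+head] : ∀ {ℓ} rest → Decreasing (ℓ ∷ rest) → FQLegal (ℓ ∷ rest) → value (ℓ ∷ rest) < Q (3 + ℓ)
value<Q[3+head] {ℓ} [] _ _ = subst (_< Q (3 + ℓ)) (sym (+-identityʳ (Q ℓ))) (Q-mono-< (m<n+m ℓ {3} z<s))
value<Q[3+head] {ℓ} (ℓ′ ∷ r) ((ℓ′<ℓ ∷ _) ∷ d) l@((gap ∷ _) ∷ _ , _) = begin-strict
  Q ℓ + value (ℓ′ ∷ r) <⟨ +-monoʳ-< (Q ℓ) (value<Q[3+head] r d (legal-tail l)) ⟩
  Q ℓ + Q (3 + ℓ′)     ≤⟨ +-monoʳ-≤ (Q ℓ) (Q-mono-≤ (s≤s (OkGap⇒2+≤ ℓ′<ℓ gap))) ⟩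
  Q ℓ + Q (1 + ℓ)      ≤⟨ Q[n]+Q[1+n]≤Q[3+n] ℓ ⟩
  Q (3 + ℓ)            ∎
  where open ≤-Reasoning

Representable-suc : ∀ {n m} → Representable n m → Representable (suc n) m
Representable-suc (ls , d , l , w , e) = ls , d , l , within-suc w , e

Representable-shrink : ∀ {N n m} → Representable N m → m < Q (suc n) → Representable n m
Representable-shrink {m = m} (ls , d , l , w , refl) m<Q =
  ls , d , l , within-restrict (All.map (λ Qi≤m → ≤-pred (Q-cancel-< (≤-<-trans Qi≤m m<Q))) (Q≤value ls)) w , refl

Representable-∷ : ∀ k {r} → Representable k r → Representable (5 + k) (Q (5 + k) + r)
Representable-∷ k (ls , d , l , w , e) =
  5 + k ∷ ls , All.map (λ (_ , i≤k) → s≤s (≤-trans i≤k (m≤n+m k 4))) w ∷ d ,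
  legal-∷ k (All.map proj₂ w) l ,
  (z<s , ≤-refl) ∷ All.map (λ (1≤i , i≤k) → 1≤i , ≤-trans i≤k (m≤n+m k 5)) w ,
  cong (Q (5 + k) +_) e

decomposition? : ∀ n m ls → Dec (Decreasing ls × FQLegal ls × All (Within n) ls × value ls ≡ m)
decomposition? n m ls =
  allPairs? (λ a b → b <? a) ls ×-dec fqLegal? ls ×-dec
  all? (λ i → 1 ≤? i ×-dec i ≤? n) ls ×-dec value ls ≟ m

decomposition : ∀ ls {t : True (decomposition? 6 (value ls) ls)} → Representable 6 (value ls)
decomposition ls {t} = ls , toWitness t

representable-6 : ∀ {m} → m < 9 → Representable 6 m
representable-6 {0} _ = decomposition []
representable-6 {1} _ = decomposition (1 ∷ [])
representable-6 {2} _ = decomposition (2 ∷ [])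
representable-6 {3} _ = decomposition (3 ∷ [])
representable-6 {4} _ = decomposition (4 ∷ [])
representable-6 {5} _ = decomposition (5 ∷ [])
representable-6 {6} _ = decomposition (4 ∷ 2 ∷ [])
representable-6 {7} _ = decomposition (6 ∷ [])
representable-6 {8} _ = decomposition (6 ∷ 1 ∷ [])
representable-6 {suc (suc (suc (suc (suc (suc (suc (suc (suc _))))))))} (s≤s (s≤s (s≤s (s≤s (s≤s (s≤s (s≤s (s≤s (s≤s ())))))))))

representable-step : ∀ k → (∀ {m} → m < Q (7 + k) → Representable (6 + k) m) →
                     (∀ {m} → m < Q (3 + k) → Representable (2 + k) m) →
                     ∀ {m} → m < Q (8 + k) → Representable (7 + k) m
representable-step k rep₆ rep₂ {m} m<Q[8+k] with m <? Q (7 + k)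
... | yes m<Q[7+k] = Representable-suc (rep₆ m<Q[7+k])
... | no  m≮Q[7+k] =
  subst (Representable (7 + k)) (m+[n∸m]≡n Q[7+k]≤m) (Representable-∷ (2 + k) (rep₂ m∸Q[7+k]<Q[3+k]))
  where
  Q[7+k]≤m : Q (7 + k) ≤ m
  Q[7+k]≤m = ≮⇒≥ m≮Q[7+k]
  m∸Q[7+k]<Q[3+k] : m ∸ Q (7 + k) < Q (3 + k)
  m∸Q[7+k]<Q[3+k] = subst (m ∸ Q (7 + k) <_) (m+n∸m≡n (Q (7 + k)) _) (∸-monoˡ-< m<Q[8+k] Q[7+k]≤m)

representable-small : ∀ {n m} → n ≤ 6 → m < Q (suc n) → Representable n m
representable-small n≤6 m<Q = Representable-shrink (representable-6 (<-≤-trans m<Q (Q-mono-≤ (s≤s n≤6)))) m<Q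

representable : ∀ n {m} → m < Q (suc n) → Representable n m
representable 0 = representable-small z≤n
representable 1 = representable-small (≤ᵇ⇒≤ _ _ tt)
representable 2 = representable-small (≤ᵇ⇒≤ _ _ tt)
representable 3 = representable-small (≤ᵇ⇒≤ _ _ tt)
representable 4 = representable-small (≤ᵇ⇒≤ _ _ tt)
representable 5 = representable-small (≤ᵇ⇒≤ _ _ tt)
representable 6 = representable-small (≤ᵇ⇒≤ _ _ tt)
representable (suc (suc (suc (suc (suc (suc (suc k))))))) =
  representable-step k (representable (suc (suc (suc (suc (suc (suc k))))))) (representable (suc (suc k)))

-- Enumerating decompositions

Qs : ℕ → List ℕ
Qs zero    = []
Qs (suc n) = Qs n ++ Q (suc n) ∷ []

length-Qs : ∀ n → length (Qs n) ≡ n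
length-Qs zero    = refl
length-Qs (suc n) = trans (length-++ (Qs n)) (trans (cong (_+ 1) (length-Qs n)) (+-comm n 1))

sum-Qs : ∀ n → sum (Qs (suc n)) ≡ sum (Qs n) + Q (suc n)
sum-Qs n = trans (sum-++ (Qs n) (Q (suc n) ∷ [])) (cong (sum (Qs n) +_) (+-identityʳ (Q (suc n))))

nth-++ : ∀ xs ys {i} → i ≤ length xs → nth (xs ++ ys) i ≡ nth xs i
nth-++ []       []       {zero}        _         = refl
nth-++ []       (_ ∷ _)  {zero}        _         = refl
nth-++ (_ ∷ _)  _        {zero}        _         = refl
nth-++ (_ ∷ _)  _        {suc zero}    _         = refl
nth-++ (_ ∷ xs) ys       {suc (suc i)} (s≤s i<) = nth-++ xs ys i<

nth-∷ʳ : ∀ xs y → nth (xs ++ y ∷ []) (suc (length xs)) ≡ y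
nth-∷ʳ []       y = refl
nth-∷ʳ (_ ∷ xs) y = nth-∷ʳ xs y

nth-Qs : ∀ {n i} → i ≤ n → nth (Qs n) i ≡ Q i
nth-Qs {zero}  z≤n = refl
nth-Qs {suc n} {i} i≤1+n with m≤n⇒m<n∨m≡n i≤1+n
... | inj₁ i<1+n = trans (nth-++ (Qs n) _ (subst (i ≤_) (sym (length-Qs n)) (≤-pred i<1+n))) (nth-Qs (≤-pred i<1+n))
... | inj₂ refl  = subst (λ l → nth (Qs n ++ Q (suc n) ∷ []) (suc l) ≡ Q (suc n)) (length-Qs n) (nth-∷ʳ (Qs n) _)

value-nth : ∀ {n ls} → All (Within n) ls → sum (map (nth (Qs n)) ls) ≡ value ls
value-nth []                = refl
value-nth ((_ , i≤n) ∷ w) = cong₂ _+_ (nth-Qs i≤n) (value-nth w)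

∈-subsets : ∀ n {ls} → Decreasing ls → All (Within n) ls → ls ∈ subsets n
∈-subsets zero    {[]}    _ _                  = here refl
∈-subsets zero    {_ ∷ _} _ ((1≤x , x≤0) ∷ _) with () ← ≤-trans 1≤x x≤0
∈-subsets (suc n) {[]}    _ _                  = ∈-++⁺ˡ (∈-subsets n [] [])
∈-subsets (suc n) {x ∷ _} d@(ls<x ∷ d′) w@((_ , x≤1+n) ∷ w′) with m≤n⇒m<n∨m≡n x≤1+n
... | inj₁ x<1+n = ∈-++⁺ˡ (∈-subsets n d (decreasing-within (≤-pred x<1+n) d w))
... | inj₂ refl  = ∈-++⁺ʳ (subsets n) (∈-map⁺ (suc n ∷_) (∈-subsets n d′ (within-restrict (All.map ≤-pred ls<x) w′)))

subsets-sound : ∀ n {ls} → ls ∈ subsets n → Decreasing ls × All (Within n) ls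
subsets-sound zero    (here refl) = [] , []
subsets-sound (suc n) ls∈ with ∈-++⁻ (subsets n) ls∈
... | inj₁ ls∈′ = let (d , w) = subsets-sound n ls∈′ in d , within-suc w
... | inj₂ ls∈′ with ∈-map⁻ (suc n ∷_) ls∈′
... | ls′ , ls′∈ , refl = let (d , w) = subsets-sound n ls′∈ in
  All.map (λ (_ , i≤n) → s≤s i≤n) w ∷ d , (z<s , ≤-refl) ∷ within-suc w

T-does⁺ : ∀ {A : Set} (a? : Dec A) → A → T (does a?)
T-does⁺ a? a = subst T (sym (dec-true a? a)) tt

T-does⁻ : ∀ {A : Set} (a? : Dec A) → T (does a?) → A
T-does⁻ (yes a) _ = a

decomposes : List ℕ → ℕ → List ℕ → Bool
decomposes ts m ls = does (fqLegal? ls ×-dec sum (map (nth ts) ls) ≟ m)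

hasDec-Qs : ∀ n m → hasDec (Qs n) m ≡ any (decomposes (Qs n) m) (subsets n)
hasDec-Qs n m = cong (λ k → any (decomposes (Qs n) m) (subsets k)) (length-Qs n)

Representable⇒hasDec : ∀ {n m} → Representable n m → T (hasDec (Qs n) m)
Representable⇒hasDec {n} {m} (ls , d , l , w , e) = subst T (sym (hasDec-Qs n m))
  (any⁺ _ (lose (∈-subsets n d w) (T-does⁺ (fqLegal? ls ×-dec _ ≟ m) (l , trans (value-nth w) e))))

hasDec⇒Representable : ∀ {n m} → T (hasDec (Qs n) m) → Representable n m
hasDec⇒Representable {n} {m} t with find (any⁻ _ (subsets n) (subst T (hasDec-Qs n m) t))
... | ls , ls∈ , ok with subsets-sound n ls∈ | T-does⁻ (fqLegal? ls ×-dec _ ≟ m) ok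
... | d , w | l , e = ls , d , l , w , trans (sym (value-nth w)) e

-- Minimality

unrepresentable-by-computation : ∀ {n m} → hasDec (Qs n) m ≡ false → ¬ Representable n m
unrepresentable-by-computation no-dec rep = subst T no-dec (Representable⇒hasDec rep)

no-decomposition-after-8+k : ∀ k rest → ¬ Representable (1 + k) (Q (2 + k)) →
  Decreasing (8 + k ∷ rest) → FQLegal (8 + k ∷ rest) → All (Within (9 + k)) rest → value rest ≢ Q (7 + k)
no-decomposition-after-8+k k [] _ _ _ _ = <⇒≢ (Q-pos (6 + k))
no-decomposition-after-8+k k (ℓ ∷ r) ¬rep ((ℓ<8+k ∷ _) ∷ d@(_ ∷ d′)) l@((gap ∷ _) ∷ _ , _) (_ ∷ w) e
  with <5+-cases (3 + k) ℓ<8+k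
... | inj₁ ℓ≤3+k = <⇒≢ (<-≤-trans (value<Q[3+head] r d (legal-tail l))
                                   (Q-mono-≤ (≤-trans (+-monoʳ-≤ 3 ℓ≤3+k) (n≤1+n (6 + k))))) e
... | inj₂ (inj₁ refl)                 = ¬OkGap[4] (4 + k) gap
... | inj₂ (inj₂ (inj₁ refl))          = ¬OkGap[3] (5 + k) gap
... | inj₂ (inj₂ (inj₂ (inj₂ refl)))   = ¬OkGap[1] (7 + k) gap
... | inj₂ (inj₂ (inj₂ (inj₁ refl)))   =
  ¬rep (r , d′ , legal-tail (legal-tail l) , rest-within r d l w , +-cancelˡ-≡ (Q (6 + k)) _ _ e)
  where
  rest-within : ∀ r → Decreasing (6 + k ∷ r) → FQLegal (8 + k ∷ 6 + k ∷ r) →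
                All (Within (9 + k)) r → All (Within (1 + k)) r
  rest-within []       _                     _                                      _       = []
  rest-within (ℓ ∷ r) ((ℓ<6+k ∷ _) ∷ d) ((_ ∷ gap₈ ∷ _) ∷ ((gap₆ ∷ _) ∷ _) , _) w
    with <5+-cases (1 + k) ℓ<6+k
  ... | inj₁ ℓ≤1+k                     = decreasing-within ℓ≤1+k d w
  ... | inj₂ (inj₁ refl)               = ⊥-elim (¬OkGap[4] (2 + k) gap₆)
  ... | inj₂ (inj₂ (inj₁ refl))        = ⊥-elim (¬OkGap[3] (3 + k) gap₆)
  ... | inj₂ (inj₂ (inj₂ (inj₁ refl))) = ⊥-elim (¬OkGap[4] (4 + k) gap₈)
  ... | inj₂ (inj₂ (inj₂ (inj₂ refl))) = ⊥-elim (¬OkGap[1] (5 + k) gap₆)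

no-decomposition-after-9+k : ∀ k rest → ¬ Representable (4 + k) (Q (5 + k)) →
  Decreasing (9 + k ∷ rest) → FQLegal (9 + k ∷ rest) → All (Within (9 + k)) rest → value rest ≢ Q (5 + k)
no-decomposition-after-9+k k [] _ _ _ _ = <⇒≢ (Q-pos (4 + k))
no-decomposition-after-9+k k (ℓ ∷ r) ¬rep ((ℓ<9+k ∷ _) ∷ d) l@((gap ∷ _) ∷ _ , _) w e
  with <5+-cases (4 + k) ℓ<9+k
... | inj₁ ℓ≤4+k                     = ¬rep (ℓ ∷ r , d , legal-tail l , decreasing-within ℓ≤4+k d w , e)
... | inj₂ (inj₁ refl)               = ¬OkGap[4] (5 + k) gap
... | inj₂ (inj₂ (inj₁ refl))        = ¬OkGap[3] (6 + k) gap
... | inj₂ (inj₂ (inj₂ (inj₂ refl))) = ¬OkGap[1] (8 + k) gap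
... | inj₂ (inj₂ (inj₂ (inj₁ refl))) =
  <⇒≢ (<-≤-trans (Q-mono-< (m<n+m (5 + k) {2} z<s)) (m≤m+n (Q (7 + k)) (value r))) (sym e)

unrepresentable-step : ∀ k → ¬ Representable (1 + k) (Q (2 + k)) → ¬ Representable (4 + k) (Q (5 + k)) →
                       ¬ Representable (9 + k) (Q (10 + k))
unrepresentable-step k _ _ ([] , _ , _ , _ , e) = <⇒≢ (Q-pos (9 + k)) e
unrepresentable-step k ¬rep₁ ¬rep₄ (ℓ ∷ rest , d , l , (_ , ℓ≤9+k) ∷ w , e) with ≤2+-cases (7 + k) ℓ≤9+k
... | inj₁ ℓ≤7+k =
  <⇒≢ (<-≤-trans (value<Q[3+head] rest d l) (Q-mono-≤ (+-monoʳ-≤ 3 ℓ≤7+k))) e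
... | inj₂ (inj₁ refl) = no-decomposition-after-8+k k rest ¬rep₁ d l w
  (+-cancelˡ-≡ (Q (8 + k)) _ _ (trans e (Q[5+n]≡Q[3+n]+Q[2+n] (5 + k))))
... | inj₂ (inj₂ refl) = no-decomposition-after-9+k k rest ¬rep₄ d l w (+-cancelˡ-≡ (Q (9 + k)) _ _ e)

unrepresentable : ∀ n → ¬ Representable n (Q (suc n))
unrepresentable 0 = unrepresentable-by-computation refl
unrepresentable 1 = unrepresentable-by-computation refl
unrepresentable 2 = unrepresentable-by-computation refl
unrepresentable 3 = unrepresentable-by-computation refl
unrepresentable 4 = unrepresentable-by-computation refl
unrepresentable 5 = unrepresentable-by-computation refl
unrepresentable 6 = unrepresentable-by-computation refl
unrepresentable 7 = unrepresentable-by-computation refl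
unrepresentable 8 = unrepresentable-by-computation refl
unrepresentable (suc (suc (suc (suc (suc (suc (suc (suc (suc k))))))))) =
  unrepresentable-step k (unrepresentable (suc k)) (unrepresentable (suc (suc (suc (suc k)))))

-- The Fibonacci Quilt sequence is Q

firstNoDec-applyUpTo : ∀ ts f {N} i d → i < N → (∀ {j} → j < i → T (hasDec ts (f j))) →
                       ¬ T (hasDec ts (f i)) → firstNoDec ts (applyUpTo f N) d ≡ f i
firstNoDec-applyUpTo ts f zero d (s≤s _) _ ¬dec with hasDec ts (f 0)
... | true  = ⊥-elim (¬dec tt)
... | false = refl
firstNoDec-applyUpTo ts f (suc i) d (s≤s i<N) dec ¬dec with hasDec ts (f 0) | dec z<s
... | true | _ = firstNoDec-applyUpTo ts (f ∘ suc) i d i<N (dec ∘ s≤s) ¬dec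

Q≤sum-Qs : ∀ {j i} → j ≤ i → Q j ≤ sum (Qs i)
Q≤sum-Qs {zero}          _       = z≤n
Q≤sum-Qs {suc j} {suc i} j≤i with m≤n⇒m<n∨m≡n j≤i
... | inj₁ j<i  = subst (Q (suc j) ≤_) (sym (sum-Qs i)) (≤-trans (Q≤sum-Qs (≤-pred j<i)) (m≤m+n _ _))
... | inj₂ refl = subst (Q (suc i) ≤_) (sym (sum-Qs i)) (m≤n+m _ _)

Q[1+n]≤1+sum-Qs : ∀ n → Q (suc n) ≤ suc (sum (Qs n))
Q[1+n]≤1+sum-Qs 0 = ≤ᵇ⇒≤ _ _ tt
Q[1+n]≤1+sum-Qs 1 = ≤ᵇ⇒≤ _ _ tt
Q[1+n]≤1+sum-Qs 2 = ≤ᵇ⇒≤ _ _ tt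
Q[1+n]≤1+sum-Qs 3 = ≤ᵇ⇒≤ _ _ tt
Q[1+n]≤1+sum-Qs 4 = ≤ᵇ⇒≤ _ _ tt
Q[1+n]≤1+sum-Qs 5 = ≤ᵇ⇒≤ _ _ tt
Q[1+n]≤1+sum-Qs (suc (suc (suc (suc (suc (suc k)))))) = begin
  Q (6 + k) + Q (2 + k)          ≤⟨ +-monoʳ-≤ (Q (6 + k)) (Q≤sum-Qs (+-monoʳ-≤ 2 (m≤n+m k 3))) ⟩
  Q (6 + k) + sum (Qs (5 + k))   ≡⟨ +-comm (Q (6 + k)) _ ⟩
  sum (Qs (5 + k)) + Q (6 + k)   ≡⟨ sum-Qs (5 + k) ⟨
  sum (Qs (6 + k))               ≤⟨ n≤1+n _ ⟩
  suc (sum (Qs (6 + k)))         ∎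
  where open ≤-Reasoning

next-Qs : ∀ n → next (Qs n) ≡ Q (suc n)
next-Qs n = begin
  firstNoDec (Qs n) (map suc (upTo S)) S ≡⟨ cong (λ l → firstNoDec (Qs n) l S) (map-upTo suc S) ⟩
  firstNoDec (Qs n) (applyUpTo suc S) S  ≡⟨ firstNoDec-applyUpTo (Qs n) suc (Q (suc n) ∸ 1) S
                                              (s≤s (∸-monoˡ-≤ 1 (Q[1+n]≤1+sum-Qs n))) decomposable
                                              (unrepresentable n ∘ hasDec⇒Representable ∘ subst HasDec 1+[Q∸1]≡Q) ⟩
  suc (Q (suc n) ∸ 1)                    ≡⟨ 1+[Q∸1]≡Q ⟩
  Q (suc n)                              ∎
  where
  open ≡-Reasoning
  S : ℕ
  S = suc (sum (Qs n))
  HasDec : ℕ → Set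
  HasDec = T ∘ hasDec (Qs n)
  1+[Q∸1]≡Q : suc (Q (suc n) ∸ 1) ≡ Q (suc n)
  1+[Q∸1]≡Q = m+[n∸m]≡n (Q-pos n)
  decomposable : ∀ {j} → j < Q (suc n) ∸ 1 → HasDec (suc j)
  decomposable {j} j<Q∸1 = Representable⇒hasDec (representable n (subst (suc j <_) 1+[Q∸1]≡Q (s≤s j<Q∸1)))

terms≡Qs : ∀ n → terms n ≡ Qs n
terms≡Qs zero    = refl
terms≡Qs (suc n) = cong₂ (λ ts t → ts ++ t ∷ []) (terms≡Qs n) (trans (cong next (terms≡Qs n)) (next-Qs n))

q≡Q : ∀ i → q i ≡ Q i
q≡Q i = trans (cong (λ ts → nth ts i) (terms≡Qs i)) (nth-Qs {i} ≤-refl)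

-- The greedy algorithm

largestIdx-Q≤ : ∀ m k → Q (largestIdx m k) ≤ m
largestIdx-Q≤ m zero = z≤n
largestIdx-Q≤ m (suc k) with q (suc k) ≤ᵇ m | ≤ᵇ-reflects-≤ (q (suc k)) m
... | true  | ofʸ qk≤m = subst (_≤ m) (q≡Q (suc k)) qk≤m
... | false | _        = largestIdx-Q≤ m k

largestIdx-≡ : ∀ {m k ℓ} → ℓ ≤ k → Q ℓ ≤ m → m < Q (suc ℓ) → largestIdx m k ≡ ℓ
largestIdx-≡ {k = zero} z≤n _ _ = refl
largestIdx-≡ {m} {suc k} {ℓ} ℓ≤1+k Qℓ≤m m<Q[1+ℓ]
  with q (suc k) ≤ᵇ m | ≤ᵇ-reflects-≤ (q (suc k)) m | m≤n⇒m<n∨m≡n ℓ≤1+k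
... | true  | _        | inj₂ refl  = refl
... | true  | ofʸ qk≤m | inj₁ ℓ<1+k =
  ⊥-elim (<⇒≱ m<Q[1+ℓ] (≤-trans (Q-mono-≤ ℓ<1+k) (subst (_≤ m) (q≡Q (suc k)) qk≤m)))
... | false | ofⁿ qk≰m | inj₂ refl  = ⊥-elim (qk≰m (subst (_≤ m) (sym (q≡Q ℓ)) Qℓ≤m))
... | false | _        | inj₁ ℓ<1+k = largestIdx-≡ (≤-pred ℓ<1+k) Qℓ≤m m<Q[1+ℓ]

largestIdx-pos : ∀ m k → 0 < largestIdx (suc m) (suc k)
largestIdx-pos m zero with q 1 ≤ᵇ suc m | ≤ᵇ-reflects-≤ (q 1) (suc m)
... | true  | _        = z<s
... | false | ofⁿ q1≰m = ⊥-elim (q1≰m (s≤s z≤n))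
largestIdx-pos m (suc k) with q (suc (suc k)) ≤ᵇ suc m
... | true  = z<s
... | false = largestIdx-pos m k

greedy-remainder≤ : ∀ r → suc r ∸ q (largestIdx (suc r) (suc r)) ≤ r
greedy-remainder≤ r with largestIdx (suc r) (suc r) | largestIdx-pos r r
... | suc ℓ | _ = ∸-monoʳ-≤ (suc r) (subst (1 ≤_) (sym (q≡Q (suc ℓ))) (Q-pos ℓ))

greedyF-fuel : ∀ {f g} r → r ≤ f → r ≤ g → greedyF f r ≡ greedyF g r
greedyF-fuel {zero}  {zero}  zero    _         _         = refl
greedyF-fuel {zero}  {suc _} zero    _         _         = refl
greedyF-fuel {suc _} {zero}  zero    _         _         = refl
greedyF-fuel {suc _} {suc _} zero    _         _         = refl
greedyF-fuel {suc f} {suc g} (suc r) (s≤s r≤f) (s≤s r≤g) =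
  cong (_ ∷_) (greedyF-fuel _ (≤-trans (greedy-remainder≤ r) r≤f) (≤-trans (greedy-remainder≤ r) r≤g))

greedy-unfold : ∀ {m} → 0 < m → greedy m ≡ largestIdx m m ∷ greedy (m ∸ q (largestIdx m m))
greedy-unfold {suc m} _ = cong (largestIdx (suc m) (suc m) ∷_) (greedyF-fuel _ (greedy-remainder≤ m) ≤-refl)

greedy-bounded : ∀ f r → All (λ i → Q i ≤ r) (greedyF f r)
greedy-bounded zero    _       = []
greedy-bounded (suc f) zero    = []
greedy-bounded (suc f) (suc r) =
  largestIdx-Q≤ (suc r) (suc r) ∷ All.map (λ Qi≤ → ≤-trans Qi≤ (m∸n≤m (suc r) (q ℓ))) (greedy-bounded f (suc r ∸ q ℓ))
  where
  ℓ : ℕ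
  ℓ = largestIdx (suc r) (suc r)

greedy-Q[6+k]+ : ∀ k {r} → r < Q (2 + k) → greedy (Q (6 + k) + r) ≡ 6 + k ∷ greedy r
greedy-Q[6+k]+ k {r} r<Q[2+k] = begin
  greedy M                                         ≡⟨ greedy-unfold (≤-trans (Q-pos (5 + k)) (m≤m+n _ r)) ⟩
  largestIdx M M ∷ greedy (M ∸ q (largestIdx M M)) ≡⟨ cong (λ ℓ → ℓ ∷ greedy (M ∸ q ℓ)) largest ⟩
  6 + k ∷ greedy (M ∸ q (6 + k))                   ≡⟨ cong (λ x → 6 + k ∷ greedy (M ∸ x)) (q≡Q (6 + k)) ⟩
  6 + k ∷ greedy (M ∸ Q (6 + k))                   ≡⟨ cong (λ x → 6 + k ∷ greedy x) (m+n∸m≡n (Q (6 + k)) r) ⟩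
  6 + k ∷ greedy r                                 ∎
  where
  open ≡-Reasoning
  M : ℕ
  M = Q (6 + k) + r
  largest : largestIdx M M ≡ 6 + k
  largest = largestIdx-≡ (≤-trans (n≤Q[n] (6 + k)) (m≤m+n _ r)) (m≤m+n _ r) (+-monoʳ-< (Q (6 + k)) r<Q[2+k])

legalGreedy : ℕ → Bool
legalGreedy m = does (fqLegal? (greedy m))

legalGreedy-Q[6+k]+ : ∀ k {r} → r < Q (2 + k) → legalGreedy (Q (6 + k) + r) ≡ legalGreedy r
legalGreedy-Q[6+k]+ k {r} r<Q[2+k] = trans (cong (does ∘ fqLegal?) (greedy-Q[6+k]+ k r<Q[2+k]))
  (does-⇔ (mk⇔ legal-tail (legal-∷ (1 + k) greedy-r≤1+k)) (fqLegal? _) (fqLegal? _))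
  where
  greedy-r≤1+k : All (_≤ 1 + k) (greedy r)
  greedy-r≤1+k = All.map (λ Qi≤r → ≤-pred (Q-cancel-< (≤-<-trans Qi≤r r<Q[2+k]))) (greedy-bounded r r)

-- Counting

countBelow : (ℕ → Bool) → ℕ → ℕ
countBelow p zero    = 0
countBelow p (suc n) = (if p 0 then 1 else 0) + countBelow (p ∘ suc) n

countBelow-+ : ∀ p m n → countBelow p (m + n) ≡ countBelow p m + countBelow (p ∘ (m +_)) n
countBelow-+ p zero    n = refl
countBelow-+ p (suc m) n = trans (cong (b +_) (countBelow-+ (p ∘ suc) m n)) (sym (+-assoc b _ _))
  where
  b : ℕ
  b = if p 0 then 1 else 0

countBelow-cong : ∀ {p p′} n → (∀ {i} → i < n → p i ≡ p′ i) → countBelow p n ≡ countBelow p′ n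
countBelow-cong zero    _    = refl
countBelow-cong (suc n) p≗p′ =
  cong₂ (λ b c → (if b then 1 else 0) + c) (p≗p′ z<s) (countBelow-cong n (p≗p′ ∘ s≤s))

length-filter-applyUpTo : ∀ {P : ℕ → Set} (P? : Decidable P) f n →
                          length (filter P? (applyUpTo f n)) ≡ countBelow (does ∘ P? ∘ f) n
length-filter-applyUpTo P? f zero = refl
length-filter-applyUpTo P? f (suc n) with does (P? (f 0))
... | true  = cong suc (length-filter-applyUpTo P? (f ∘ suc) n)
... | false = length-filter-applyUpTo P? (f ∘ suc) n

-- Since greedy 0 = [] is legal, m = 0 contributes the extra 1.
1+h≡countBelow : ∀ n → suc (h n) ≡ countBelow legalGreedy (Q (suc n))
1+h≡countBelow n = begin
  suc (length (filter legal? (map suc (upTo (q (suc n) ∸ 1)))))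
    ≡⟨ cong (λ ms → suc (length (filter legal? ms))) (map-upTo suc (q (suc n) ∸ 1)) ⟩
  suc (length (filter legal? (applyUpTo suc (q (suc n) ∸ 1))))
    ≡⟨ cong suc (length-filter-applyUpTo legal? suc (q (suc n) ∸ 1)) ⟩
  countBelow legalGreedy (suc (q (suc n) ∸ 1))
    ≡⟨ cong (λ x → countBelow legalGreedy (suc (x ∸ 1))) (q≡Q (suc n)) ⟩
  countBelow legalGreedy (suc (Q (suc n) ∸ 1))
    ≡⟨ cong (countBelow legalGreedy) (m+[n∸m]≡n (Q-pos n)) ⟩
  countBelow legalGreedy (Q (suc n))
    ∎
  where
  open ≡-Reasoning
  legal? : Decidable (FQLegal ∘ greedy)
  legal? m = fqLegal? (greedy m)

countBelow-Q[7+k] : ∀ k → countBelow legalGreedy (Q (7 + k)) ≡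
                          countBelow legalGreedy (Q (6 + k)) + countBelow legalGreedy (Q (2 + k))
countBelow-Q[7+k] k = trans (countBelow-+ legalGreedy (Q (6 + k)) (Q (2 + k)))
  (cong (countBelow legalGreedy (Q (6 + k)) +_) (countBelow-cong (Q (2 + k)) (legalGreedy-Q[6+k]+ k)))

h-recurrence : ∀ k → h (6 + k) ≡ h (5 + k) + h (1 + k) + 1
h-recurrence k = suc-injective (begin
  suc (h (6 + k))                                     ≡⟨ 1+h≡countBelow (6 + k) ⟩
  countBelow legalGreedy (Q (7 + k))                  ≡⟨ countBelow-Q[7+k] k ⟩
  countBelow legalGreedy (Q (6 + k)) +
  countBelow legalGreedy (Q (2 + k))                  ≡⟨ cong₂ _+_ (1+h≡countBelow (5 + k)) (1+h≡countBelow (1 + k)) ⟨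
  suc (h (5 + k)) + suc (h (1 + k))                   ≡⟨ cong suc (trans (+-suc _ _) (+-comm 1 _)) ⟩
  suc (h (5 + k) + h (1 + k) + 1)                     ∎)
  where open ≡-Reasoning

lemma4p1 : ((k : ℕ) → 1 ≤ k → k ≤ 5 → h k ≡ k)
         × ((n : ℕ) → 6 ≤ n → h n ≡ h (n ∸ 1) + h (n ∸ 5) + 1)
lemma4p1 = initial , recurrence
  where
  initial : (k : ℕ) → 1 ≤ k → k ≤ 5 → h k ≡ k
  initial 1 _ _ = refl
  initial 2 _ _ = refl
  initial 3 _ _ = refl
  initial 4 _ _ = refl
  initial 5 _ _ = refl
  initial (suc (suc (suc (suc (suc (suc _)))))) _ (s≤s (s≤s (s≤s (s≤s (s≤s ())))))
  recurrence : (n : ℕ) → 6 ≤ n → h n ≡ h (n ∸ 1) + h (n ∸ 5) + 1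
  recurrence n 6≤n with m≤n⇒∃[o]m+o≡n 6≤n
  ... | k , refl = h-recurrence k
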